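{- Let $M$ be an LP$^{\text{MLN}}$ program and $(X,Y)$ an SE-interpretation. Then (1) if $X=Y$, $(X,Y)$ is an SE-model of $M$; and (2) $(X,Y)$ is not an SE-model of $M$ if and only if $X$ does not satisfy $(\overline{M_Y})^Y$.
   Context: A literal is an atom or its classical negation; a set of literals is consistent if it does not contain an atom together with its negation. A ground ASP rule $r$ has the form $l_1\vee\dots\vee l_k\leftarrow l_{k+1},\dots,l_m,\ not\ l_{m+1},\dots,not\ l_n$; $h(r)=\{l_1,\dots,l_k\}$, $b^+(r)=\{l_{k+1},\dots,l_m\}$, $b^-(r)=\{l_{m+1},\dots,l_n\}$. A consistent set $X$ satisfies $r$ if $b^+(r)\subseteq X$ and $b^-(r)\cap X=\emptyset$ imply $h(r)\cap X\neq\emptyset$. The GL-reduct of an ASP program $P$ w.r.t. $Y$ is $P^Y=\{h(r)\leftarrow b^+(r)\mid r\in P,\ b^-(r)\cap Y=\emptyset\}$. An LP$^{\text{MLN}}$ program is a finite set of ground weighted rules $w:r$, with $w$ a real number or the symbol $\alpha$. For a program $M$: $\overline{M}=\{r\mid w:r\in M\}$ and $M_Y=\{w:r\in M\mid Y\text{ satisfies }r\}$. An SE-interpretation is a pair $(X,Y)$ of consistent sets of literals with $X\subseteq Y$; it is an SE-model of $M$ if both $X$ and $Y$ satisfy $(\overline{M_Y})^Y$. -}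

module Defs where

open import Data.List using (List)
open import Data.List.Membership.Propositional using (_∈_)
open import Data.List.Relation.Unary.All using (All)
open import Data.List.Relation.Unary.Any using (Any)
open import Data.Product using (Σ; _×_; ∃-syntax)
open import Data.Empty using (⊥)
open import Relation.Nullary using (¬_)
open import Relation.Binary.PropositionalEquality using (_≡_)

data Literal (A : Set) : Set where
  pos : A → Literal A
  neg : A → Literal A

LitSet : Set → Set₁
LitSet A = Literal A → Set

_⊆_ : {A : Set} → LitSet A → LitSet A → Set
X ⊆ Y = ∀ l → X l → Y l

Consistent : {A : Set} → LitSet A → Set
Consistent X = ∀ a → ¬ (X (pos a) × X (neg a))

-- Ground ASP rule  h ← b⁺ , not b⁻  (heads/bodies as finite lists).
record Rule (A : Set) : Set where
  constructor rule
  field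
    head  : List (Literal A)
    bpos  : List (Literal A)
    bneg  : List (Literal A)
open Rule public

Satisfies : {A : Set} → LitSet A → Rule A → Set
Satisfies X r = All X (bpos r) → All (λ l → ¬ X l) (bneg r) → Any X (head r)

-- Weights: a real number (abstracted as an arbitrary type R) or the symbol α.
data Weight (R : Set) : Set where
  real  : R → Weight R
  alpha : Weight R

record WRule (R A : Set) : Set where
  constructor _∶_
  field
    weight : Weight R
    wrule  : Rule A
open WRule public

LPMLN : Set → Set → Set
LPMLN R A = List (WRule R A)

Program : Set → Set₁
Program A = Rule A → Set

SatisfiesProg : {A : Set} → LitSet A → Program A → Set
SatisfiesProg X P = ∀ r → P r → Satisfies X r

overline : {R A : Set} → LPMLN R A → Program A
overline M r = ∃[ w ] (w ∶ r) ∈ M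

M-sub : {R A : Set} → LPMLN R A → LitSet A → WRule R A → Set
M-sub M Y wr = wr ∈ M × Satisfies Y (wrule wr)

overlineMY : {R A : Set} → LPMLN R A → LitSet A → Program A
overlineMY M Y r = ∃[ w ] M-sub M Y (w ∶ r)

GL : {A : Set} → Program A → LitSet A → Program A
GL P Y r' = ∃[ r ] (P r × All (λ l → ¬ Y l) (bneg r) × r' ≡ rule (head r) (bpos r) List.[])

record SEInterp {A : Set} (X Y : LitSet A) : Set where
  field
    consX : Consistent X
    consY : Consistent Y
    sub   : X ⊆ Y

SEModel : {R A : Set} → LPMLN R A → LitSet A → LitSet A → Set
SEModel M X Y = SatisfiesProg X (GL (overlineMY M Y) Y) × SatisfiesProg Y (GL (overlineMY M Y) Y)

{-# OPTIONS --safe #-}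
module Submission where

open import Defs
open import Data.Product using (_×_; _,_; proj₁)
open import Relation.Nullary using (¬_)
open import Relation.Binary.PropositionalEquality using (_≡_; refl)
open import Function.Bundles using (_⇔_; mk⇔)
open import Function.Related.TypeIsomorphisms using (¬-cong-⇔)

-- Y satisfies the reduct P^Y whenever it satisfies P: a reduct rule only drops
-- negative body literals, which are absent from Y by the reduct's side condition.
satisfies-GL : {A : Set} (P : Program A) (Y : LitSet A) →
  SatisfiesProg Y P → SatisfiesProg Y (GL P Y)
satisfies-GL P Y sat-P _ (r , r∈P , b⁻∩Y≡∅ , refl) b⁺⊆Y _ = sat-P r r∈P b⁺⊆Y b⁻∩Y≡∅

satisfies-overlineMY : {R A : Set} (M : LPMLN R A) (Y : LitSet A) →
  SatisfiesProg Y (overlineMY M Y)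
satisfies-overlineMY M Y r (_ , _ , Y⊨r) = Y⊨r

satisfies-GL-overlineMY : {R A : Set} (M : LPMLN R A) (Y : LitSet A) →
  SatisfiesProg Y (GL (overlineMY M Y) Y)
satisfies-GL-overlineMY M Y = satisfies-GL (overlineMY M Y) Y (satisfies-overlineMY M Y)

SEModel⇔satisfies-GL : {R A : Set} (M : LPMLN R A) (X Y : LitSet A) →
  SEModel M X Y ⇔ SatisfiesProg X (GL (overlineMY M Y) Y)
SEModel⇔satisfies-GL M X Y =
  mk⇔ proj₁ (λ X⊨MY → X⊨MY , satisfies-GL-overlineMY M Y)

SEModel-diagonal : {R A : Set} (M : LPMLN R A) (Y : LitSet A) → SEModel M Y Y
SEModel-diagonal M Y = satisfies-GL-overlineMY M Y , satisfies-GL-overlineMY M Y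

proposition1 : {R A : Set} (M : LPMLN R A) (X Y : LitSet A) → SEInterp X Y →
    ((X ≡ Y → SEModel M X Y) × ((¬ SEModel M X Y) ⇔ (¬ SatisfiesProg X (GL (overlineMY M Y) Y))))
proposition1 M X Y _ =
  (λ { refl → SEModel-diagonal M X }) ,
  ¬-cong-⇔ (SEModel⇔satisfies-GL M X Y)
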